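{- Let $S$ be a Boolean sublattice all of whose quarks have size $2$. If $S$ is a UFS, then: (1) the pairing graph $\mathcal{G}_p(S)$ contains no cycle of length $3$; and (2) $\mathcal{G}_p(S)$ contains no path of length $4$ and no cycle of length $4$.
   Context: Let $B_{\mathbb{N}}$ be the set of all finite subsets of $\mathbb{N}=\{1,2,3,\dots\}$, ordered by inclusion. A Boolean sublattice is a subset $S\subseteq B_{\mathbb{N}}$ containing $\emptyset$ and closed under finite unions. A quark of $S$ is a nonempty $A\in S$ such that no $B\in S$ satisfies $\emptyset\subsetneq B\subsetneq A$; $\mathcal{A}(S)$ is the set of quarks. For nonempty $X\in S$, a factorization of $X$ in $S$ is a finite set $z\subseteq\mathcal{A}(S)$ with $\bigcup z=X$ and $\bigcup z'\subsetneq X$ for every proper subset $z'\subsetneq z$. $S$ is a UFS if every nonempty $X\in S$ has exactly one factorization in $S$. When all quarks have size at most $2$, the pairing graph $\mathcal{G}_p(S)$ is the simple graph with vertex set $\mathbb{N}$ and an edge between distinct $a,b$ whenever $\{a,b\}\in\mathcal{A}(S)$. A path of length $\ell$ uses $\ell$ edges and $\ell+1$ distinct vertices; a cycle of length $\ell$ uses $\ell$ edges through $\ell$ distinct vertices. -}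

module Defs where

open import Data.Nat using (ℕ; zero)
open import Data.List using (List; []; _∷_; _++_; concat)
open import Data.List.Membership.Propositional using (_∈_; _∉_)
open import Data.List.Relation.Unary.Any using (Any)
open import Data.List.Relation.Unary.All using (All)
open import Data.List.Relation.Unary.Unique.Propositional using (Unique)
open import Data.Product using (_×_; ∃; Σ)
open import Relation.Nullary using (¬_)
open import Relation.Binary.PropositionalEquality using (_≢_)

-- A finite subset of ℕ is represented by a list of its elements
-- (order and repetitions irrelevant); sets are compared extensionally.
FinSet : Set
FinSet = List ℕ

_⊆ₛ_ : FinSet → FinSet → Set
A ⊆ₛ B = ∀ x → x ∈ A → x ∈ B

_≐_ : FinSet → FinSet → Set
A ≐ B = (A ⊆ₛ B) × (B ⊆ₛ A)

_⊊ₛ_ : FinSet → FinSet → Set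
A ⊊ₛ B = (A ⊆ₛ B) × ¬ (B ⊆ₛ A)

NonEmpty : FinSet → Set
NonEmpty A = ∃ λ x → x ∈ A

Family : Set₁
Family = FinSet → Set

-- Boolean sublattice of B_ℕ (ℕ = {1,2,...}: no member contains 0).
-- The first field says S is a genuine family of sets (invariant under
-- change of list representation).
record BooleanSublattice (S : Family) : Set where
  field
    respects : ∀ {X Y} → X ≐ Y → S X → S Y
    noZero   : ∀ X → S X → zero ∉ X
    hasEmpty : S []
    unionClosed : ∀ X Y → S X → S Y → S (X ++ Y)

Quark : Family → FinSet → Set
Quark S A = S A × NonEmpty A × (∀ B → S B → ¬ (NonEmpty B × B ⊊ₛ A))

-- Finite sets of finite sets: lists of FinSets, membership up to ≐.
_∈≐_ : FinSet → List FinSet → Set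
A ∈≐ z = Any (A ≐_) z

_⊆≐_ : List FinSet → List FinSet → Set
z ⊆≐ w = ∀ A → A ∈≐ z → A ∈≐ w

_≈≐_ : List FinSet → List FinSet → Set
z ≈≐ w = (z ⊆≐ w) × (w ⊆≐ z)

_⊊≐_ : List FinSet → List FinSet → Set
z ⊊≐ w = (z ⊆≐ w) × ¬ (w ⊆≐ z)

⋃ : List FinSet → FinSet
⋃ = concat

Factorization : Family → FinSet → List FinSet → Set
Factorization S X z =
  All (Quark S) z × (⋃ z ≐ X) × (∀ z' → z' ⊊≐ z → ⋃ z' ⊊ₛ X)

UFS : Family → Set
UFS S = ∀ X → S X → NonEmpty X →
          (∃ λ z → Factorization S X z)
        × (∀ z w → Factorization S X z → Factorization S X w → z ≈≐ w)

QuarksOfSize2 : Family → Set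
QuarksOfSize2 S = ∀ A → Quark S A → Σ ℕ λ a → Σ ℕ λ b → a ≢ b × A ≐ (a ∷ b ∷ [])

Edge : Family → ℕ → ℕ → Set
Edge S a b = a ≢ b × Quark S (a ∷ b ∷ [])

HasCycle3 : Family → Set
HasCycle3 S = Σ ℕ λ a → Σ ℕ λ b → Σ ℕ λ c →
  Unique (a ∷ b ∷ c ∷ []) × Edge S a b × Edge S b c × Edge S c a

HasPath4 : Family → Set
HasPath4 S = Σ ℕ λ v0 → Σ ℕ λ v1 → Σ ℕ λ v2 → Σ ℕ λ v3 → Σ ℕ λ v4 →
  Unique (v0 ∷ v1 ∷ v2 ∷ v3 ∷ v4 ∷ []) ×
  Edge S v0 v1 × Edge S v1 v2 × Edge S v2 v3 × Edge S v3 v4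

HasCycle4 : Family → Set
HasCycle4 S = Σ ℕ λ v0 → Σ ℕ λ v1 → Σ ℕ λ v2 → Σ ℕ λ v3 →
  Unique (v0 ∷ v1 ∷ v2 ∷ v3 ∷ []) ×
  Edge S v0 v1 × Edge S v1 v2 × Edge S v2 v3 × Edge S v3 v0

-- Each forbidden configuration makes one set of S the union of two
-- different families of quarks: a triangle abc gives ab ∪ bc = ab ∪ ca, a
-- path v0…v4 gives v0v1 ∪ v1v2 ∪ v3v4 = v0v1 ∪ v2v3 ∪ v3v4, and a square
-- v0v1v2v3 gives v0v1 ∪ v2v3 = v1v2 ∪ v3v0.  In every such family each edge
-- owns an endpoint lying in no other member, so no proper subfamily has
-- the same union and both families are factorizations, contradicting
-- uniqueness.
module Submission where

open import Defs
open import Data.Fin using (#_)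
open import Data.List using (List; []; _∷_; map)
open import Data.List.Membership.Propositional using (_∈_; _∉_)
open import Data.List.Membership.Propositional.Properties
  using (∈-concat⁻′; ∈-lookup; ∈-++⁺ˡ; ∈-++⁺ʳ)
open import Data.List.Relation.Unary.All as All using (All; []; _∷_)
open import Data.List.Relation.Unary.All.Properties using (All¬⇒¬Any)
open import Data.List.Relation.Unary.AllPairs using (AllPairs; []; _∷_)
open import Data.List.Relation.Unary.Any using (here; there)
import Data.List.Relation.Unary.Any as Any
open import Data.List.Relation.Unary.Any.Properties using (map⁻)
open import Data.Nat using (ℕ)
open import Data.Product using (_×_; _,_; ∃; proj₁; proj₂)
open import Data.Empty using (⊥-elim)
open import Relation.Nullary using (¬_)
open import Relation.Binary.PropositionalEquality using (refl; _≢_; ≢-sym)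

≐-refl : ∀ {A} → A ≐ A
≐-refl = (λ _ x∈ → x∈) , (λ _ x∈ → x∈)

≐-sym : ∀ {A B} → A ≐ B → B ≐ A
≐-sym (A⊆B , B⊆A) = B⊆A , A⊆B

≐-trans : ∀ {A B C} → A ≐ B → B ≐ C → A ≐ C
≐-trans (A⊆B , B⊆A) (B⊆C , C⊆B) =
  (λ x x∈A → B⊆C x (A⊆B x x∈A)) , (λ x x∈C → B⊆A x (C⊆B x x∈C))

⊆ₛ-fromAll : ∀ {A B} → All (_∈ B) A → A ⊆ₛ B
⊆ₛ-fromAll A⊆B _ = All.lookup A⊆B

∈∉⇒¬≐ : ∀ {A B x} → x ∈ A → x ∉ B → ¬ A ≐ B
∈∉⇒¬≐ x∈A x∉B (A⊆B , _) = x∉B (A⊆B _ x∈A)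

∉-pair : ∀ {x a b : ℕ} → x ≢ a → x ≢ b → x ∉ a ∷ b ∷ []
∉-pair x≢a x≢b = All¬⇒¬Any (x≢a ∷ x≢b ∷ [])

∈⇒∈≐ : ∀ {A z} → A ∈ z → A ∈≐ z
∈⇒∈≐ = Any.map (λ { refl → ≐-refl })

∈≐⇒⊆⋃ : ∀ {A z} → A ∈≐ z → A ⊆ₛ ⋃ z
∈≐⇒⊆⋃ (here (A⊆B , _)) x x∈A = ∈-++⁺ˡ (A⊆B x x∈A)
∈≐⇒⊆⋃ {z = B ∷ _} (there A∈z) x x∈A = ∈-++⁺ʳ B (∈≐⇒⊆⋃ A∈z x x∈A)

⊆≐⇒⋃⊆ : ∀ {z w} → z ⊆≐ w → ⋃ z ⊆ₛ ⋃ w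
⊆≐⇒⋃⊆ {z} z⊆w x x∈⋃z with ∈-concat⁻′ z x∈⋃z
... | A , x∈A , A∈z = ∈≐⇒⊆⋃ (z⊆w A (∈⇒∈≐ A∈z)) x x∈A

⋃-closed : ∀ {S} → BooleanSublattice S → ∀ {z} → All S z → S (⋃ z)
⋃-closed bs [] = BooleanSublattice.hasEmpty bs
⋃-closed bs (SA ∷ Sz) = BooleanSublattice.unionClosed bs _ _ SA (⋃-closed bs Sz)

Private : List FinSet → FinSet → ℕ → Set
Private z A p = p ∈ A × (∀ B → B ∈≐ z → p ∈ B → B ≐ A)

Irredundant : List FinSet → Set
Irredundant z = ∀ A → A ∈≐ z → ∃ (Private z A)

irredundant-⊆≐ : ∀ {z w} → Irredundant z → ⋃ z ⊆ₛ ⋃ w → w ⊆≐ z → z ⊆≐ w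
irredundant-⊆≐ {w = w} irr ⋃z⊆⋃w w⊆z A A∈z with irr A A∈z
... | p , p∈A , p-private with ∈-concat⁻′ w (⋃z⊆⋃w p (∈≐⇒⊆⋃ A∈z p p∈A))
... | B , p∈B , B∈w =
  Any.map (λ { refl → ≐-sym (p-private B (w⊆z B (∈⇒∈≐ B∈w)) p∈B) }) B∈w

irredundantCover⇒factorization : ∀ {S X z} → All (Quark S) z → ⋃ z ≐ X →
                                 Irredundant z → Factorization S X z
irredundantCover⇒factorization {X = X} {z} quarks (⋃z⊆X , X⊆⋃z) irr =
  quarks , (⋃z⊆X , X⊆⋃z) , minimal
  where
  minimal : ∀ w → w ⊊≐ z → ⋃ w ⊊ₛ X
  minimal w (w⊆z , z⊈w) =
      (λ x x∈⋃w → ⋃z⊆X x (⊆≐⇒⋃⊆ w⊆z x x∈⋃w))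
    , (λ X⊆⋃w → z⊈w (irredundant-⊆≐ irr (λ x x∈⋃z → X⊆⋃w x (⋃z⊆X x x∈⋃z)) w⊆z))

Separated : List (FinSet × ℕ) → Set
Separated zs = All (λ (A , p) → p ∈ A) zs
             × AllPairs (λ (A , p) (B , q) → p ∉ B × q ∉ A) zs

separated⇒private : ∀ zs → Separated zs → All (λ (A , p) → Private (map proj₁ zs) A p) zs
separated⇒private [] _ = []
separated⇒private ((A , p) ∷ zs) (p∈A ∷ inside , apart ∷ separated) =
  (p∈A , p-private) ∷ All.zipWith extend (apart , separated⇒private zs (inside , separated))
  where
  p-private : ∀ B → B ∈≐ (A ∷ map proj₁ zs) → p ∈ B → B ≐ A
  p-private B (here B≐A) _ = B≐A
  p-private B (there B∈zs) p∈B =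
    ⊥-elim (All.lookupWith (λ (p∉C , _) (B⊆C , _) → p∉C (B⊆C p p∈B)) apart (map⁻ B∈zs))
  extend : ∀ {Cq : FinSet × ℕ} → (p ∉ proj₁ Cq × proj₂ Cq ∉ A) × Private (map proj₁ zs) (proj₁ Cq) (proj₂ Cq)
         → Private (A ∷ map proj₁ zs) (proj₁ Cq) (proj₂ Cq)
  extend ((_ , q∉A) , q∈C , q-private) = q∈C , λ
    { B (here (B⊆A , _)) q∈B → ⊥-elim (q∉A (B⊆A _ q∈B))
    ; B (there B∈zs) q∈B → q-private B B∈zs q∈B }

separated⇒irredundant : ∀ zs → Separated zs → Irredundant (map proj₁ zs)
separated⇒irredundant zs sep A A∈zs =
  All.lookupWith transport (separated⇒private zs sep) (map⁻ A∈zs)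
  where
  transport : ∀ {Bp : FinSet × ℕ} → Private (map proj₁ zs) (proj₁ Bp) (proj₂ Bp) → A ≐ proj₁ Bp
            → ∃ (Private (map proj₁ zs) A)
  transport (p∈B , p-private) A≐B =
    _ , proj₂ A≐B _ p∈B , λ C C∈zs p∈C → ≐-trans (p-private C C∈zs p∈C) (≐-sym A≐B)

SeparatedQuarks : Family → List (FinSet × ℕ) → Set
SeparatedQuarks S zs = All (Quark S) (map proj₁ zs) × Separated zs

module _ {S : Family} (bs : BooleanSublattice S) (ufs : UFS S) where

  separatedQuarkCovers-⊆≐ : ∀ zs ws → SeparatedQuarks S zs → SeparatedQuarks S ws →
                            NonEmpty (⋃ (map proj₁ zs)) → ⋃ (map proj₁ ws) ≐ ⋃ (map proj₁ zs) →
                            map proj₁ zs ⊆≐ map proj₁ ws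
  separatedQuarkCovers-⊆≐ zs ws (quarks-z , sep-z) (quarks-w , sep-w) nonEmpty ⋃w≐⋃z =
    proj₁ (proj₂ (ufs _ (⋃-closed bs (All.map proj₁ quarks-z)) nonEmpty) _ _
      (irredundantCover⇒factorization quarks-z ≐-refl (separated⇒irredundant zs sep-z))
      (irredundantCover⇒factorization quarks-w ⋃w≐⋃z (separated⇒irredundant ws sep-w)))

  noCycle3 : ¬ HasCycle3 S
  noCycle3 (a , b , c , ((a≢b ∷ a≢c ∷ []) ∷ (b≢c ∷ []) ∷ [] ∷ []) , (_ , ab) , (_ , bc) , (_ , ca)) =
    bc∉≐ws (separatedQuarkCovers-⊆≐ zs ws (ab ∷ bc ∷ [] , sep-z) (ab ∷ ca ∷ [] , sep-w)
              (a , here refl) ⋃ws≐⋃zs _ (there (here ≐-refl)))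
    where
    zs ws : List (FinSet × ℕ)
    zs = (a ∷ b ∷ [] , a) ∷ (b ∷ c ∷ [] , c) ∷ []
    ws = (a ∷ b ∷ [] , b) ∷ (c ∷ a ∷ [] , c) ∷ []
    a∉bc : a ∉ b ∷ c ∷ []
    a∉bc = ∉-pair a≢b a≢c
    b∉ca : b ∉ c ∷ a ∷ []
    b∉ca = ∉-pair b≢c (≢-sym a≢b)
    c∉ab : c ∉ a ∷ b ∷ []
    c∉ab = ∉-pair (≢-sym a≢c) (≢-sym b≢c)
    sep-z : Separated zs
    sep-z = (∈-lookup (# 0) ∷ ∈-lookup (# 1) ∷ []) , ((a∉bc , c∉ab) ∷ []) ∷ [] ∷ []
    sep-w : Separated ws
    sep-w = (∈-lookup (# 1) ∷ ∈-lookup (# 0) ∷ []) , ((b∉ca , c∉ab) ∷ []) ∷ [] ∷ []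
    ⋃ws≐⋃zs : ⋃ (map proj₁ ws) ≐ ⋃ (map proj₁ zs)
    ⋃ws≐⋃zs = ⊆ₛ-fromAll (∈-lookup (# 0) ∷ ∈-lookup (# 1) ∷ ∈-lookup (# 3) ∷ ∈-lookup (# 0) ∷ [])
            , ⊆ₛ-fromAll (∈-lookup (# 0) ∷ ∈-lookup (# 1) ∷ ∈-lookup (# 1) ∷ ∈-lookup (# 2) ∷ [])
    bc∉≐ws : ¬ (b ∷ c ∷ []) ∈≐ map proj₁ ws
    bc∉≐ws = All¬⇒¬Any (∈∉⇒¬≐ (∈-lookup (# 1)) c∉ab ∷ ∈∉⇒¬≐ (∈-lookup (# 0)) b∉ca ∷ [])

  noPath4 : ¬ HasPath4 S
  noPath4 (v0 , v1 , v2 , v3 , v4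
          , ((0≢1 ∷ 0≢2 ∷ 0≢3 ∷ 0≢4 ∷ []) ∷ (1≢2 ∷ 1≢3 ∷ 1≢4 ∷ []) ∷ (2≢3 ∷ 2≢4 ∷ []) ∷ (3≢4 ∷ []) ∷ [] ∷ [])
          , (_ , e01) , (_ , e12) , (_ , e23) , (_ , e34)) =
    v1v2∉≐ws (separatedQuarkCovers-⊆≐ zs ws (e01 ∷ e12 ∷ e34 ∷ [] , sep-z) (e01 ∷ e23 ∷ e34 ∷ [] , sep-w)
                (v0 , here refl) ⋃ws≐⋃zs _ (there (here ≐-refl)))
    where
    zs ws : List (FinSet × ℕ)
    zs = (v0 ∷ v1 ∷ [] , v0) ∷ (v1 ∷ v2 ∷ [] , v2) ∷ (v3 ∷ v4 ∷ [] , v3) ∷ []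
    ws = (v0 ∷ v1 ∷ [] , v0) ∷ (v2 ∷ v3 ∷ [] , v2) ∷ (v3 ∷ v4 ∷ [] , v4) ∷ []
    sep-z : Separated zs
    sep-z = (∈-lookup (# 0) ∷ ∈-lookup (# 1) ∷ ∈-lookup (# 0) ∷ [])
          , ((∉-pair 0≢1 0≢2 , ∉-pair (≢-sym 0≢2) (≢-sym 1≢2)) ∷ (∉-pair 0≢3 0≢4 , ∉-pair (≢-sym 0≢3) (≢-sym 1≢3)) ∷ [])
          ∷ ((∉-pair 2≢3 2≢4 , ∉-pair (≢-sym 1≢3) (≢-sym 2≢3)) ∷ [])
          ∷ [] ∷ []
    sep-w : Separated ws
    sep-w = (∈-lookup (# 0) ∷ ∈-lookup (# 0) ∷ ∈-lookup (# 1) ∷ [])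
          , ((∉-pair 0≢2 0≢3 , ∉-pair (≢-sym 0≢2) (≢-sym 1≢2)) ∷ (∉-pair 0≢3 0≢4 , ∉-pair (≢-sym 0≢4) (≢-sym 1≢4)) ∷ [])
          ∷ ((∉-pair 2≢3 2≢4 , ∉-pair (≢-sym 2≢4) (≢-sym 3≢4)) ∷ [])
          ∷ [] ∷ []
    ⋃ws≐⋃zs : ⋃ (map proj₁ ws) ≐ ⋃ (map proj₁ zs)
    ⋃ws≐⋃zs = ⊆ₛ-fromAll (∈-lookup (# 0) ∷ ∈-lookup (# 1) ∷ ∈-lookup (# 3) ∷ ∈-lookup (# 4) ∷ ∈-lookup (# 4) ∷ ∈-lookup (# 5) ∷ [])
            , ⊆ₛ-fromAll (∈-lookup (# 0) ∷ ∈-lookup (# 1) ∷ ∈-lookup (# 1) ∷ ∈-lookup (# 2) ∷ ∈-lookup (# 3) ∷ ∈-lookup (# 5) ∷ [])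
    v1v2∉≐ws : ¬ (v1 ∷ v2 ∷ []) ∈≐ map proj₁ ws
    v1v2∉≐ws = All¬⇒¬Any ( ∈∉⇒¬≐ (∈-lookup (# 1)) (∉-pair (≢-sym 0≢2) (≢-sym 1≢2))
                         ∷ ∈∉⇒¬≐ (∈-lookup (# 0)) (∉-pair 1≢2 1≢3)
                         ∷ ∈∉⇒¬≐ (∈-lookup (# 0)) (∉-pair 1≢3 1≢4) ∷ [])

  noCycle4 : ¬ HasCycle4 S
  noCycle4 (v0 , v1 , v2 , v3
           , ((0≢1 ∷ 0≢2 ∷ 0≢3 ∷ []) ∷ (1≢2 ∷ 1≢3 ∷ []) ∷ (2≢3 ∷ []) ∷ [] ∷ [])
           , (_ , e01) , (_ , e12) , (_ , e23) , (_ , e30)) =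
    v0v1∉≐ws (separatedQuarkCovers-⊆≐ zs ws (e01 ∷ e23 ∷ [] , sep-z) (e12 ∷ e30 ∷ [] , sep-w)
                (v0 , here refl) ⋃ws≐⋃zs _ (here ≐-refl))
    where
    zs ws : List (FinSet × ℕ)
    zs = (v0 ∷ v1 ∷ [] , v0) ∷ (v2 ∷ v3 ∷ [] , v2) ∷ []
    ws = (v1 ∷ v2 ∷ [] , v1) ∷ (v3 ∷ v0 ∷ [] , v3) ∷ []
    sep-z : Separated zs
    sep-z = (∈-lookup (# 0) ∷ ∈-lookup (# 0) ∷ [])
          , ((∉-pair 0≢2 0≢3 , ∉-pair (≢-sym 0≢2) (≢-sym 1≢2)) ∷ []) ∷ [] ∷ []
    sep-w : Separated ws
    sep-w = (∈-lookup (# 0) ∷ ∈-lookup (# 0) ∷ [])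
          , ((∉-pair 1≢3 (≢-sym 0≢1) , ∉-pair (≢-sym 1≢3) (≢-sym 2≢3)) ∷ []) ∷ [] ∷ []
    ⋃ws≐⋃zs : ⋃ (map proj₁ ws) ≐ ⋃ (map proj₁ zs)
    ⋃ws≐⋃zs = ⊆ₛ-fromAll (∈-lookup (# 1) ∷ ∈-lookup (# 2) ∷ ∈-lookup (# 3) ∷ ∈-lookup (# 0) ∷ [])
            , ⊆ₛ-fromAll (∈-lookup (# 3) ∷ ∈-lookup (# 0) ∷ ∈-lookup (# 1) ∷ ∈-lookup (# 2) ∷ [])
    v0v1∉≐ws : ¬ (v0 ∷ v1 ∷ []) ∈≐ map proj₁ ws
    v0v1∉≐ws = All¬⇒¬Any ( ∈∉⇒¬≐ (∈-lookup (# 0)) (∉-pair 0≢1 0≢2)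
                         ∷ ∈∉⇒¬≐ (∈-lookup (# 1)) (∉-pair 1≢3 (≢-sym 0≢1)) ∷ [])

lemma4p5 : (S : Family) → BooleanSublattice S → QuarksOfSize2 S → UFS S →
    ¬ HasCycle3 S × (¬ HasPath4 S × ¬ HasCycle4 S)
lemma4p5 S bs _ ufs = noCycle3 bs ufs , noPath4 bs ufs , noCycle4 bs ufs
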